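{- Let $R$ be an $n$-ary cyclic and $2$-transitive relation on $\mathbb{Q}^k$ with $n\ge3$. If $R$ is preserved by $mi$, then $R$ contains a min-clean tuple.
   Context: An $n$-ary relation on $\mathbb{Q}^k$ is a nonempty set of tuples $t=(t_1,\dots,t_n)$, $t_i\in\mathbb{Q}^k$; cyclic means invariant under cyclic shifts of coordinates; $2$-transitive means invariant under coordinate permutations from some $2$-transitive subgroup of $\mathrm{Sym}(n)$. For $a\in\mathbb{Q}^k$, $\min(a)$ is its least entry and $\mathrm{minx}(a)=\{i:a_i=\min(a)\}$. $\min(t)$ is the least entry of $t$, $M(t)=\{i\in[n]:\min(t_i)=\min(t)\}$, and $t$ is min-clean if $\mathrm{minx}(t_i)=\mathrm{minx}(t_j)$ for all $i,j\in M(t)$. Given strictly increasing $\alpha,\beta,\gamma:\mathbb{Q}\to\mathbb{Q}$ with $\alpha(x)<\beta(x)<\gamma(x)<\alpha(x+\epsilon)$ for all $x,\epsilon>0$, $mi(x,y)=\alpha(\min(x,y))$ if $x=y$, $\beta(\min(x,y))$ if $x<y$, $\gamma(\min(x,y))$ if $x>y$; "preserved by $mi$" means closed under componentwise application of $mi$ for every admissible choice of $\alpha,\beta,\gamma$. -}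

module Defs where

open import Data.Nat as ℕ using (ℕ; zero; suc; _%_)
open import Data.Nat.DivMod using (m%n<n)
open import Data.Fin using (Fin; zero; suc; toℕ; fromℕ<)
open import Data.Fin.Permutation using (Permutation′; _⟨$⟩ʳ_; id; flip; _∘ₚ_)
open import Data.Rational using (ℚ; 0ℚ; _⊓_; _<_; _+_)
open import Data.Rational.Properties using (_≟_; _<?_)
open import Data.Product using (Σ; _×_; ∃)
open import Relation.Binary.PropositionalEquality using (_≡_; _≢_)
open import Relation.Nullary using (yes; no)

Point : ℕ → Set
Point k = Fin k → ℚ

Tuple : ℕ → ℕ → Set
Tuple n k = Fin n → Point k

-- Minimum of a finite family of rationals (default 0 for the empty
-- family; only used for nonempty families in the statement).
minF : ∀ {m} → (Fin m → ℚ) → ℚ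
minF {zero} _ = 0ℚ
minF {suc zero} a = a zero
minF {suc (suc m)} a = a zero ⊓ minF (λ i → a (suc i))

minx : ∀ {k} → Point k → Fin k → Set
minx a i = a i ≡ minF a

minT : ∀ {n k} → Tuple n k → ℚ
minT t = minF (λ i → minF (t i))

M : ∀ {n k} → Tuple n k → Fin n → Set
M t i = minF (t i) ≡ minT t

MinClean : ∀ {n k} → Tuple n k → Set
MinClean {n} {k} t =
  ∀ (i j : Fin n) → M t i → M t j →
    ∀ (l : Fin k) → (minx (t i) l → minx (t j) l) × (minx (t j) l → minx (t i) l)

Relation : ℕ → ℕ → Set₁
Relation n k = Tuple n k → Set

Nonempty : ∀ {n k} → Relation n k → Set
Nonempty R = ∃ λ t → R t

next : ∀ {n} → Fin n → Fin n
next {suc m} i = fromℕ< (m%n<n (suc (toℕ i)) (suc m))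

Cyclic : ∀ {n k} → Relation n k → Set
Cyclic R = ∀ t → R t → R (λ i → t (next i))

IsSubgroup : ∀ {n} → (Permutation′ n → Set) → Set
IsSubgroup G =
  G id × (∀ π ρ → G π → G ρ → G (π ∘ₚ ρ)) × (∀ π → G π → G (flip π))

TwoTransitiveGroup : ∀ {n} → (Permutation′ n → Set) → Set
TwoTransitiveGroup {n} G =
  ∀ (i j i′ j′ : Fin n) → i ≢ j → i′ ≢ j′ →
    ∃ λ π → G π × (π ⟨$⟩ʳ i ≡ i′) × (π ⟨$⟩ʳ j ≡ j′)

TwoTransitive : ∀ {n k} → Relation n k → Set₁
TwoTransitive {n} R =
  Σ (Permutation′ n → Set) λ G →
    IsSubgroup G × TwoTransitiveGroup G ×
    (∀ π → G π → ∀ t → R t → R (λ i → t (π ⟨$⟩ʳ i)))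

StrictlyIncreasing : (ℚ → ℚ) → Set
StrictlyIncreasing f = ∀ x y → x < y → f x < f y

Admissible : (ℚ → ℚ) → (ℚ → ℚ) → (ℚ → ℚ) → Set
Admissible α β γ =
  StrictlyIncreasing α × StrictlyIncreasing β × StrictlyIncreasing γ ×
  (∀ x → α x < β x) × (∀ x → β x < γ x) ×
  (∀ x ε → 0ℚ < ε → γ x < α (x + ε))

mi : (ℚ → ℚ) → (ℚ → ℚ) → (ℚ → ℚ) → ℚ → ℚ → ℚ
mi α β γ x y with x ≟ y | x <? y
... | yes _ | _     = α (x ⊓ y)
... | no _  | yes _ = β (x ⊓ y)
... | no _  | no _  = γ (x ⊓ y)

PreservedByMi : ∀ {n k} → Relation n k → Set
PreservedByMi R =
  ∀ α β γ → Admissible α β γ →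
    ∀ s t → R s → R t → R (λ i l → mi α β γ (s i l) (t i l))

{-# OPTIONS --safe #-}
-- Fix an admissible triple and t ∈ R with least entry m.  If t is not min-clean there are
-- rows i, j ∈ M(t) and a column l with t i l = m ≠ t j l.  Two-transitivity, applied with a
-- third row (this is where n ≥ 3 is used), gives σ in the group that fixes i or j and maps a
-- row with entry m in column l to one without.  Then mi(t, t ∘ σ) lies in R, its least entry
-- is α m (attained in the fixed row), and it is attained only where t and t ∘ σ both equal m.
-- So it has strictly fewer minimal entries than t, and iterating ends at a min-clean tuple.
--
-- Admissible triples exist: stair x = Σ_{j ≥ 1} 2^-j ⌊j! x⌋ / j! is increasing, and since
-- ⌊j! y⌋ < j! x for y < x once the denominator d of x divides j!, it jumps by at least
-- 2^-d / d! at x.  So α x = - stair (- x) jumps to the right of every x, leaving room for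
-- β x and γ x strictly between α x and every α y with y > x.
module Submission where

import Data.Nat.Base as ℕ
import Data.Nat.Properties as ℕ
open import Data.Nat.Base using (ℕ; zero; suc)
open import Data.Fin.Base using (Fin; zero; suc)
open import Data.Fin.Permutation using (Permutation′; _⟨$⟩ʳ_)
open import Data.Product using (∃; _×_)
open import Data.Product.Base using (_,_; proj₁; proj₂)
open import Data.Sum.Base using (_⊎_; inj₁; inj₂; [_,_]′)
open import Function.Base using (_∘_)
open import Relation.Nullary using (¬_; Dec; yes; no; contradiction)
open import Relation.Binary.PropositionalEquality
  using (_≡_; _≢_; refl; sym; trans; cong; subst; subst₂; module ≡-Reasoning)
open import Defs

module ScaledFloor where
  open import Data.Integer.Base using (ℤ; +_; _*_; _≤_; _<_; +<+; Positive; positive)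
    renaming (suc to sucℤ)
  open import Data.Integer.Properties
  open import Data.Integer.DivMod using (_/ℕ_; [n/ℕd]*d≤n; n<s[n/ℕd]*d)
  open import Data.Rational.Base as ℚ using (ℚ; ↥_; ↧_; ↧ₙ_)
  open import Data.Rational.Properties using (drop-*≤*; drop-*<*)
  open import Data.Nat.Divisibility using (_∣_; divides)
  open import Algebra.Properties.CommutativeSemigroup *-commutativeSemigroup
    using (xy∙z≈xz∙y; xy∙z≈x∙zy)
  open ≤-Reasoning

  ≤-/ℕ : ∀ {k} n d .{{_ : ℕ.NonZero d}} → k * + d ≤ n → k ≤ n /ℕ d
  ≤-/ℕ {k} n d k*d≤n = ≮⇒≥ λ n/d<k → <-irrefl refl (begin-strict
    n                    <⟨ n<s[n/ℕd]*d n d ⟩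
    sucℤ (n /ℕ d) * + d  ≤⟨ *-monoʳ-≤-nonNeg (+ d) (i<j⇒suc[i]≤j n/d<k) ⟩
    k * + d              ≤⟨ k*d≤n ⟩
    n                    ∎)

  ⌊_·_⌋ : ℕ → ℚ → ℤ
  ⌊ m · x ⌋ = (+ m * ↥ x) /ℕ ↧ₙ x

  ⌊·⌋*↧≤ : ∀ m x → ⌊ m · x ⌋ * ↧ x ≤ + m * ↥ x
  ⌊·⌋*↧≤ m x = [n/ℕd]*d≤n (+ m * ↥ x) (↧ₙ x)

  ≤⌊·⌋ : ∀ {z} m x → z * ↧ x ≤ + m * ↥ x → z ≤ ⌊ m · x ⌋
  ≤⌊·⌋ m x = ≤-/ℕ (+ m * ↥ x) (↧ₙ x)

  ⌊·⌋-mono : ∀ m {x y} → x ℚ.≤ y → ⌊ m · x ⌋ ≤ ⌊ m · y ⌋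
  ⌊·⌋-mono m {x} {y} x≤y =
    ≤⌊·⌋ m y (*-cancelʳ-≤-pos (⌊ m · x ⌋ * ↧ y) (+ m * ↥ y) (↧ x) (begin
      ⌊ m · x ⌋ * ↧ y * ↧ x  ≡⟨ xy∙z≈xz∙y ⌊ m · x ⌋ (↧ y) (↧ x) ⟩
      ⌊ m · x ⌋ * ↧ x * ↧ y  ≤⟨ *-monoʳ-≤-nonNeg (↧ y) (⌊·⌋*↧≤ m x) ⟩
      + m * ↥ x * ↧ y        ≡⟨ *-assoc (+ m) (↥ x) (↧ y) ⟩
      + m * (↥ x * ↧ y)      ≤⟨ *-monoˡ-≤-nonNeg (+ m) (drop-*≤* x≤y) ⟩
      + m * (↥ y * ↧ x)      ≡⟨ *-assoc (+ m) (↥ y) (↧ x) ⟨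
      + m * ↥ y * ↧ x        ∎))

  scale-denominator : ∀ q x → + (q ℕ.* ↧ₙ x) * ↥ x ≡ + q * ↥ x * ↧ x
  scale-denominator q x = begin-equality
    + (q ℕ.* ↧ₙ x) * ↥ x  ≡⟨ cong (_* ↥ x) (pos-* q (↧ₙ x)) ⟩
    + q * ↧ x * ↥ x        ≡⟨ xy∙z≈xz∙y (+ q) (↧ x) (↥ x) ⟩
    + q * ↥ x * ↧ x        ∎

  ⌊·⌋-exact : ∀ q x → ⌊ q ℕ.* ↧ₙ x · x ⌋ ≡ + q * ↥ x
  ⌊·⌋-exact q x = ≤-antisym
    (*-cancelʳ-≤-pos _ (+ q * ↥ x) (↧ x)
      (≤-trans (⌊·⌋*↧≤ (q ℕ.* ↧ₙ x) x) (≤-reflexive (scale-denominator q x))))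
    (≤⌊·⌋ (q ℕ.* ↧ₙ x) x (≤-reflexive (sym (scale-denominator q x))))

  ⌊·⌋-jump : ∀ {m} .{{_ : ℕ.NonZero m}} {x y} → ↧ₙ x ∣ m → y ℚ.< x → ⌊ m · y ⌋ < ⌊ m · x ⌋
  ⌊·⌋-jump {x = x} {y} (divides q refl) y<x rewrite ⌊·⌋-exact q x =
    *-cancelʳ-<-nonNeg (↧ y) (begin-strict
      ⌊ q ℕ.* ↧ₙ x · y ⌋ * ↧ y  ≤⟨ ⌊·⌋*↧≤ (q ℕ.* ↧ₙ x) y ⟩
      + (q ℕ.* ↧ₙ x) * ↥ y      ≡⟨ cong (_* ↥ y) (pos-* q (↧ₙ x)) ⟩
      + q * ↧ x * ↥ y            ≡⟨ xy∙z≈x∙zy (+ q) (↧ x) (↥ y) ⟩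
      + q * (↥ y * ↧ x)          <⟨ *-monoˡ-<-pos (+ q) {{q>0}} (drop-*<* y<x) ⟩
      + q * (↥ x * ↧ y)          ≡⟨ *-assoc (+ q) (↥ x) (↧ y) ⟨
      + q * ↥ x * ↧ y            ∎)
    where
    q>0 : Positive (+ q)
    q>0 = positive (+<+ (ℕ.>-nonZero⁻¹ q {{ℕ.m*n≢0⇒m≢0 q}}))

module Stair where
  open import Data.Integer.Base as ℤ using (+_) renaming (suc to sucℤ)
  import Data.Integer.Properties as ℤ
  open import Data.Rational.Base
    using (ℚ; _+_; _*_; _≤_; _<_; 0ℚ; 1ℚ; ½; 1/_; ↥_; ↧_; ↧ₙ_; Positive; NonNegative; *≤*)
  open import Data.Rational.Properties
  open import Data.Rational.Literals using (fromℤ)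
  import Data.Rational.Solver as ℚ
  import Data.Rational.Unnormalised.Base as ℚᵘ
  import Data.Rational.Unnormalised.Properties as ℚᵘ
  open import Data.Nat.Base using (_!; s≤s; z≤n)
  open import Data.Nat.Properties using (_!≢0; m≤n⇒m<n∨m≡n)
  open import Data.Nat.Divisibility using (_∣_; divides; ∣-trans; m∣m*n; m≤n⇒m!∣n!)
  open ScaledFloor using (⌊_·_⌋; ⌊·⌋-mono; ⌊·⌋-exact; ⌊·⌋-jump; scale-denominator)

  fromℤ-mono-≤ : ∀ {a b} → a ℤ.≤ b → fromℤ a ≤ fromℤ b
  fromℤ-mono-≤ {a} {b} a≤b =
    *≤* (subst₂ ℤ._≤_ (sym (ℤ.*-identityʳ a)) (sym (ℤ.*-identityʳ b)) a≤b)

  fromℤ-suc : ∀ a → fromℤ (sucℤ a) ≡ fromℤ a + 1ℚ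
  fromℤ-suc a =
    toℚᵘ-injective (ℚᵘ.≃-sym (ℚᵘ.≃-trans (toℚᵘ-homo-+ (fromℤ a) 1ℚ) (ℚᵘ.*≡* eq)))
    where
    eq : (a ℤ.* + 1 ℤ.+ + 1) ℤ.* + 1 ≡ (+ 1 ℤ.+ a) ℤ.* + 1
    eq = cong (ℤ._* + 1) (trans (cong (ℤ._+ + 1) (ℤ.*-identityʳ a)) (ℤ.+-comm a (+ 1)))

  fromℤ-⌊·⌋ : ∀ {m} x → ↧ₙ x ∣ m → fromℤ ⌊ m · x ⌋ ≡ fromℤ (+ m) * x
  fromℤ-⌊·⌋ x@record{} (divides q refl) = trans (cong fromℤ (⌊·⌋-exact q x))
    (toℚᵘ-injective (ℚᵘ.≃-sym (ℚᵘ.≃-trans (toℚᵘ-homo-* (fromℤ (+ (q ℕ.* ↧ₙ x))) x) (ℚᵘ.*≡* eq))))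
    where
    open ≡-Reasoning
    eq : + (q ℕ.* ↧ₙ x) ℤ.* ↥ x ℤ.* + 1 ≡ + q ℤ.* ↥ x ℤ.* + (1 ℕ.* ↧ₙ x)
    eq = begin
      + (q ℕ.* ↧ₙ x) ℤ.* ↥ x ℤ.* + 1  ≡⟨ ℤ.*-identityʳ _ ⟩
      + (q ℕ.* ↧ₙ x) ℤ.* ↥ x          ≡⟨ scale-denominator q x ⟩
      + q ℤ.* ↥ x ℤ.* ↧ x              ≡⟨ cong (λ d → + q ℤ.* ↥ x ℤ.* + d) (ℕ.*-identityˡ (↧ₙ x)) ⟨
      + q ℤ.* ↥ x ℤ.* + (1 ℕ.* ↧ₙ x)  ∎

  m≤n⇒m∣n! : ∀ {m n} .{{_ : ℕ.NonZero m}} → m ℕ.≤ n → m ∣ n !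
  m≤n⇒m∣n! {suc m} m≤n = ∣-trans (m∣m*n (m !)) (m≤n⇒m!∣n! m≤n)

  ½*p+½*p≡p : ∀ p → ½ * p + ½ * p ≡ p
  ½*p+½*p≡p p = trans (sym (*-distribʳ-+ p ½ ½)) (*-identityˡ p)

  p+q+r≡p+r+q : ∀ p q r → p + q + r ≡ p + r + q
  p+q+r≡p+r+q = solve 3 (λ p q r → p :+ q :+ r := p :+ r :+ q) refl
    where open ℚ.+-*-Solver using (solve; _:=_; _:+_)

  ½^_ : ℕ → ℚ
  ½^ zero  = 1ℚ
  ½^ suc n = ½ * ½^ n

  ½^-pos : ∀ n → Positive (½^ n)
  ½^-pos zero    = _
  ½^-pos (suc n) = pos*pos⇒pos ½ (½^ n) {{½^-pos n}}

  ½^-nonNeg : ∀ n → NonNegative (½^ n)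
  ½^-nonNeg n = pos⇒nonNeg (½^ n) {{½^-pos n}}

  weight : ℕ → ℚ
  weight j = ½^ j * (1/ fromℤ (+ (j !))) {{j !≢0}}

  weight-pos : ∀ j → Positive (weight j)
  weight-pos j = pos*pos⇒pos (½^ j) {{½^-pos j}} _ {{1/pos⇒pos (fromℤ (+ (j !))) {{j!-pos}}}}
    where
    j!-pos : Positive (fromℤ (+ (j !)))
    j!-pos = ℤ.positive (ℤ.+<+ (ℕ.1≤n! j))

  weight-nonNeg : ∀ j → NonNegative (weight j)
  weight-nonNeg j = pos⇒nonNeg (weight j) {{weight-pos j}}

  weight*j!≡½^j : ∀ j → weight j * fromℤ (+ (j !)) ≡ ½^ j
  weight*j!≡½^j j = begin
    ½^ j * 1/j! * j!    ≡⟨ *-assoc (½^ j) 1/j! j! ⟩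
    ½^ j * (1/j! * j!)  ≡⟨ cong (½^ j *_) (*-inverseˡ j! {{j !≢0}}) ⟩
    ½^ j * 1ℚ           ≡⟨ *-identityʳ (½^ j) ⟩
    ½^ j                ∎
    where
    open ≡-Reasoning
    j! : ℚ
    j! = fromℤ (+ (j !))
    1/j! : ℚ
    1/j! = (1/ j!) {{j !≢0}}

  term : ℕ → ℚ → ℚ
  term j x = weight j * fromℤ ⌊ j ! · x ⌋

  term-mono : ∀ j {x y} → x ≤ y → term j x ≤ term j y
  term-mono j x≤y =
    *-monoˡ-≤-nonNeg (weight j) {{weight-nonNeg j}} (fromℤ-mono-≤ (⌊·⌋-mono (j !) x≤y))

  term-exact : ∀ j {x} → ↧ₙ x ∣ j ! → term j x ≡ ½^ j * x
  term-exact j {x} d∣j! = begin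
    weight j * fromℤ ⌊ j ! · x ⌋      ≡⟨ cong (weight j *_) (fromℤ-⌊·⌋ x d∣j!) ⟩
    weight j * (fromℤ (+ (j !)) * x)  ≡⟨ *-assoc (weight j) _ x ⟨
    weight j * fromℤ (+ (j !)) * x    ≡⟨ cong (_* x) (weight*j!≡½^j j) ⟩
    ½^ j * x                          ∎
    where open ≡-Reasoning

  term-jump : ∀ j {x y} → ↧ₙ x ∣ j ! → y < x → term j y + weight j ≤ term j x
  term-jump j {x} {y} d∣j! y<x = begin
    term j y + weight j                           ≡⟨ cong (λ w → term j y + w) (*-identityʳ (weight j)) ⟨
    weight j * fromℤ ⌊ j ! · y ⌋ + weight j * 1ℚ  ≡⟨ *-distribˡ-+ (weight j) _ 1ℚ ⟨
    weight j * (fromℤ ⌊ j ! · y ⌋ + 1ℚ)           ≡⟨ cong (weight j *_) (fromℤ-suc ⌊ j ! · y ⌋) ⟨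
    weight j * fromℤ (sucℤ ⌊ j ! · y ⌋)           ≤⟨ *-monoˡ-≤-nonNeg (weight j) {{weight-nonNeg j}}
                                                       (fromℤ-mono-≤ (ℤ.i<j⇒suc[i]≤j ⌊j!y⌋<⌊j!x⌋)) ⟩
    weight j * fromℤ ⌊ j ! · x ⌋                  ∎
    where
    open ≤-Reasoning
    ⌊j!y⌋<⌊j!x⌋ : ⌊ j ! · y ⌋ ℤ.< ⌊ j ! · x ⌋
    ⌊j!y⌋<⌊j!x⌋ = ⌊·⌋-jump {{j !≢0}} d∣j! y<x

  steps : ℕ → ℚ → ℚ
  steps zero    x = 0ℚ
  steps (suc N) x = steps N x + term (suc N) x

  steps-mono : ∀ N {x y} → x ≤ y → steps N x ≤ steps N y
  steps-mono zero    x≤y = ≤-refl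
  steps-mono (suc N) x≤y = +-mono-≤ (steps-mono N x≤y) (term-mono (suc N) x≤y)

  steps-jump : ∀ {j} N {x y} → 1 ℕ.≤ j → j ℕ.≤ N → ↧ₙ x ∣ j ! → y < x →
               steps N y + weight j ≤ steps N x
  steps-jump zero (s≤s _) ()
  steps-jump {j} (suc N) {x} {y} 1≤j j≤1+N d∣j! y<x with m≤n⇒m<n∨m≡n j≤1+N
  ... | inj₁ j≤N = begin
    steps N y + term (suc N) y + weight j  ≡⟨ p+q+r≡p+r+q (steps N y) _ (weight j) ⟩
    steps N y + weight j + term (suc N) y  ≤⟨ +-mono-≤ (steps-jump N 1≤j (ℕ.s≤s⁻¹ j≤N) d∣j! y<x)
                                                       (term-mono (suc N) (<⇒≤ y<x)) ⟩
    steps N x + term (suc N) x             ∎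
    where open ≤-Reasoning
  ... | inj₂ refl = begin
    steps N y + term (suc N) y + weight j    ≡⟨ +-assoc (steps N y) _ _ ⟩
    steps N y + (term (suc N) y + weight j)  ≤⟨ +-mono-≤ (steps-mono N (<⇒≤ y<x))
                                                         (term-jump (suc N) d∣j! y<x) ⟩
    steps N x + term (suc N) x               ∎
    where open ≤-Reasoning

  -- ½^ N * x is the sum of the terms j > N once the denominator of x divides N!.
  staircase : ℕ → ℚ → ℚ
  staircase N x = steps N x + ½^ N * x

  staircase-jump : ∀ N {x y} → ↧ₙ x ℕ.≤ N → y < x →
                   staircase N y + weight (↧ₙ x) ≤ staircase N x
  staircase-jump N {x} {y} d≤N y<x = begin
    steps N y + ½^ N * y + weight d  ≡⟨ p+q+r≡p+r+q (steps N y) _ (weight d) ⟩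
    steps N y + weight d + ½^ N * y  ≤⟨ +-mono-≤ (steps-jump N (s≤s z≤n) d≤N (m≤n⇒m∣n! ℕ.≤-refl) y<x)
                                                 (*-monoˡ-≤-nonNeg (½^ N) {{½^-nonNeg N}} (<⇒≤ y<x)) ⟩
    steps N x + ½^ N * x             ∎
    where
    open ≤-Reasoning
    d : ℕ
    d = ↧ₙ x

  staircase-suc : ∀ N {x} → ↧ₙ x ∣ suc N ! → staircase (suc N) x ≡ staircase N x
  staircase-suc N {x} d∣N! = begin
    steps N x + term (suc N) x + ½^ suc N * x  ≡⟨ cong (λ w → steps N x + w + ½^ suc N * x)
                                                       (term-exact (suc N) d∣N!) ⟩
    steps N x + ½^ suc N * x + ½^ suc N * x    ≡⟨ +-assoc (steps N x) _ _ ⟩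
    steps N x + (½^ suc N * x + ½^ suc N * x)  ≡⟨ cong (λ w → steps N x + w) halves ⟩
    steps N x + ½^ N * x                       ∎
    where
    open ≡-Reasoning
    halves : ½^ suc N * x + ½^ suc N * x ≡ ½^ N * x
    halves = trans (sym (*-distribʳ-+ x (½^ suc N) (½^ suc N))) (cong (_* x) (½*p+½*p≡p (½^ N)))

  staircase-stable : ∀ N {x} → ↧ₙ x ℕ.≤ N → staircase N x ≡ staircase (↧ₙ x) x
  staircase-stable (suc N) d≤1+N with m≤n⇒m<n∨m≡n d≤1+N
  ... | inj₁ d≤N  = trans (staircase-suc N (m≤n⇒m∣n! d≤1+N)) (staircase-stable N (ℕ.s≤s⁻¹ d≤N))
  ... | inj₂ refl = refl

  stair : ℚ → ℚ
  stair x = staircase (↧ₙ x) x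

  stair-jump : ∀ {x y} → y < x → stair y + weight (↧ₙ x) ≤ stair x
  stair-jump {x} {y} y<x = begin
    stair y + weight (↧ₙ x)        ≡⟨ cong (_+ weight (↧ₙ x)) (staircase-stable N (ℕ.m≤n+m (↧ₙ y) (↧ₙ x))) ⟨
    staircase N y + weight (↧ₙ x)  ≤⟨ staircase-jump N (ℕ.m≤m+n (↧ₙ x) (↧ₙ y)) y<x ⟩
    staircase N x                  ≡⟨ staircase-stable N (ℕ.m≤m+n (↧ₙ x) (↧ₙ y)) ⟩
    stair x                        ∎
    where
    open ≤-Reasoning
    N : ℕ
    N = ↧ₙ x ℕ.+ ↧ₙ y

module AdmissibleTriple where
  open import Data.Rational.Base using (ℚ; _+_; _*_; -_; _≤_; _<_; 0ℚ; ½; ↧ₙ_; positive)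
  open import Data.Rational.Properties
  import Data.Rational.Solver as ℚ
  open Stair using (½*p+½*p≡p; weight; weight-pos; stair; stair-jump)

  p<p+q : ∀ p {q} → 0ℚ < q → p < p + q
  p<p+q p {q} 0<q = subst (_< p + q) (+-identityʳ p) (+-monoʳ-< p 0<q)

  0<½*p : ∀ {p} → 0ℚ < p → 0ℚ < ½ * p
  0<½*p {p} 0<p = positive⁻¹ (½ * p) {{pos*pos⇒pos ½ p {{positive 0<p}}}}

  ½*p<p : ∀ {p} → 0ℚ < p → ½ * p < p
  ½*p<p {p} 0<p = subst (½ * p <_) (½*p+½*p≡p p) (p<p+q (½ * p) (0<½*p 0<p))

  a+c≤b⇒-b+c≤-a : ∀ {a b} c → a + c ≤ b → - b + c ≤ - a
  a+c≤b⇒-b+c≤-a {a} {b} c a+c≤b = begin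
    - b + c        ≤⟨ +-monoˡ-≤ c (neg-antimono-≤ a+c≤b) ⟩
    - (a + c) + c  ≡⟨ solve 2 (λ a c → :- (a :+ c) :+ c := :- a) refl a c ⟩
    - a            ∎
    where
    open ≤-Reasoning
    open ℚ.+-*-Solver using (solve; _:=_; _:+_; :-_)

  jump⇒admissible : ∀ {α g : ℚ → ℚ} → (∀ x → 0ℚ < g x) → (∀ {x y} → x < y → α x + g x ≤ α y) →
                    Admissible α (λ x → α x + ½ * (½ * g x)) (λ x → α x + ½ * g x)
  jump⇒admissible {α} {g} g-pos α-jump = α-inc , β-inc , γ-inc , α<β , β<γ , λ x _ → γ<α ∘ p<p+q x
    where
    α<β : ∀ x → α x < α x + ½ * (½ * g x)
    α<β x = p<p+q (α x) (0<½*p (0<½*p (g-pos x)))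
    β<γ : ∀ x → α x + ½ * (½ * g x) < α x + ½ * g x
    β<γ x = +-monoʳ-< (α x) (½*p<p (0<½*p (g-pos x)))
    γ<α : ∀ {x y} → x < y → α x + ½ * g x < α y
    γ<α {x} x<y = <-≤-trans (+-monoʳ-< (α x) (½*p<p (g-pos x))) (α-jump x<y)
    α-inc : StrictlyIncreasing α
    α-inc x y x<y = <-trans (α<β x) (<-trans (β<γ x) (γ<α x<y))
    β-inc : StrictlyIncreasing (λ x → α x + ½ * (½ * g x))
    β-inc x y x<y = <-trans (β<γ x) (<-trans (γ<α x<y) (α<β y))
    γ-inc : StrictlyIncreasing (λ x → α x + ½ * g x)
    γ-inc x y x<y = <-trans (γ<α x<y) (<-trans (α<β y) (β<γ y))

  ∃-admissible : ∃ λ α → ∃ λ β → ∃ λ γ → Admissible α β γ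
  ∃-admissible = _ , _ , _ ,
    jump⇒admissible {α = λ x → - stair (- x)} {g = λ x → weight (↧ₙ (- x))}
      (λ x → positive⁻¹ _ {{weight-pos (↧ₙ (- x))}})
      (λ x<y → a+c≤b⇒-b+c≤-a _ (stair-jump (neg-antimono-< x<y)))

module Minimum where
  open import Data.Rational.Base using (ℚ; _≤_; _⊓_)
  open import Data.Rational.Properties
    using (≤-refl; ≤-trans; ≤-antisym; p⊓q≤p; p⊓q≤q; ⊓-glb; ⊓-sel)

  minF-≤ : ∀ {m} (a : Fin m → ℚ) i → minF a ≤ a i
  minF-≤ {suc zero}    a zero    = ≤-refl
  minF-≤ {suc (suc m)} a zero    = p⊓q≤p (a zero) _
  minF-≤ {suc (suc m)} a (suc i) = ≤-trans (p⊓q≤q (a zero) _) (minF-≤ (a ∘ suc) i)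

  minF-glb : ∀ {m c} (a : Fin (suc m) → ℚ) → (∀ i → c ≤ a i) → c ≤ minF a
  minF-glb {zero}  a c≤a = c≤a zero
  minF-glb {suc m} a c≤a = ⊓-glb (c≤a zero) (minF-glb (a ∘ suc) (c≤a ∘ suc))

  minF-attained : ∀ {m} (a : Fin (suc m) → ℚ) → ∃ λ i → a i ≡ minF a
  minF-attained {zero}  a = zero , refl
  minF-attained {suc m} a with ⊓-sel (a zero) (minF (a ∘ suc)) | minF-attained (a ∘ suc)
  ... | inj₁ a₀≡min   | _           = zero , sym a₀≡min
  ... | inj₂ rest≡min | i , ai≡rest = suc i , trans ai≡rest (sym rest≡min)

  minT-≤ : ∀ {n k} (t : Tuple n k) i l → minT t ≤ t i l
  minT-≤ t i l = ≤-trans (minF-≤ (λ i → minF (t i)) i) (minF-≤ (t i) l)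

  minT-unique : ∀ {n k c} (t : Tuple (suc n) (suc k)) i l →
                (∀ i l → c ≤ t i l) → t i l ≡ c → minT t ≡ c
  minT-unique t i l c≤t til≡c = ≤-antisym
    (subst (minT t ≤_) til≡c (minT-≤ t i l))
    (minF-glb (λ i → minF (t i)) (λ i → minF-glb (t i) (c≤t i)))

  M⇒minEntry : ∀ {n k} (t : Tuple n (suc k)) {i} → M t i → ∃ λ l → t i l ≡ minT t
  M⇒minEntry t {i} Mi with minF-attained (t i)
  ... | l , til≡min = l , trans til≡min Mi

module MiProperties {α β γ} (adm : Admissible α β γ) where
  open import Data.Rational.Base using (_≤_; _<_; _⊓_)
  open import Data.Rational.Properties
  open import Relation.Binary.Definitions using (tri<; tri≈; tri>)
  open Minimum using (minT-≤; minT-unique)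

  private
    α-inc : StrictlyIncreasing α
    α-inc = proj₁ adm
    α<β : ∀ x → α x < β x
    α<β = proj₁ (proj₂ (proj₂ (proj₂ adm)))
    β<γ : ∀ x → β x < γ x
    β<γ = proj₁ (proj₂ (proj₂ (proj₂ (proj₂ adm))))

  α-mono : ∀ {x y} → x ≤ y → α x ≤ α y
  α-mono {x} {y} x≤y with <-cmp x y
  ... | tri< x<y _ _  = <⇒≤ (α-inc x y x<y)
  ... | tri≈ _ refl _ = ≤-refl
  ... | tri> _ _ y<x  = contradiction (<-≤-trans y<x x≤y) (<-irrefl refl)

  α-cancel-≤ : ∀ {x y} → α x ≤ α y → x ≤ y
  α-cancel-≤ {x} {y} αx≤αy = ≮⇒≥ λ y<x → <-irrefl refl (<-≤-trans (α-inc y x y<x) αx≤αy)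

  α⊓≤mi : ∀ x y → α (x ⊓ y) ≤ mi α β γ x y
  α⊓≤mi x y with x ≟ y | x <? y
  ... | yes _ | _     = ≤-refl
  ... | no _  | yes _ = <⇒≤ (α<β (x ⊓ y))
  ... | no _  | no _  = <⇒≤ (<-trans (α<β (x ⊓ y)) (β<γ (x ⊓ y)))

  mi≡α⊓⇒≡ : ∀ x y → mi α β γ x y ≡ α (x ⊓ y) → x ≡ y
  mi≡α⊓⇒≡ x y e with x ≟ y | x <? y
  ... | yes x≡y | _     = x≡y
  ... | no _    | yes _ = contradiction (sym e) (<⇒≢ (α<β (x ⊓ y)))
  ... | no _    | no _  = contradiction (sym e) (<⇒≢ (<-trans (α<β (x ⊓ y)) (β<γ (x ⊓ y))))

  mi-diag : ∀ x → mi α β γ x x ≡ α x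
  mi-diag x with x ≟ x | x <? x
  ... | yes _  | _ = cong α (⊓-idem x)
  ... | no x≢x | _ = contradiction refl x≢x

  α≤mi : ∀ {m x y} → m ≤ x → m ≤ y → α m ≤ mi α β γ x y
  α≤mi {x = x} {y} m≤x m≤y = ≤-trans (α-mono (⊓-glb m≤x m≤y)) (α⊓≤mi x y)

  mi≡α⇒≡ : ∀ {m x y} → m ≤ x → m ≤ y → mi α β γ x y ≡ α m → x ≡ m × y ≡ m
  mi≡α⇒≡ {m} {x} {y} m≤x m≤y e = x≡m , trans (sym x≡y) x≡m
    where
    x⊓y≡m : x ⊓ y ≡ m
    x⊓y≡m = ≤-antisym (α-cancel-≤ (subst (α (x ⊓ y) ≤_) e (α⊓≤mi x y))) (⊓-glb m≤x m≤y)
    x≡y : x ≡ y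
    x≡y = mi≡α⊓⇒≡ x y (trans e (cong α (sym x⊓y≡m)))
    x≡m : x ≡ m
    x≡m = trans (sym (⊓-idem x)) (trans (cong (x ⊓_) x≡y) x⊓y≡m)

  miPerm : ∀ {n k} → Permutation′ n → Tuple n k → Tuple n k
  miPerm σ t i l = mi α β γ (t i l) (t (σ ⟨$⟩ʳ i) l)

  minT-miPerm : ∀ {n k} (t : Tuple (suc n) (suc k)) σ {p l} →
                σ ⟨$⟩ʳ p ≡ p → t p l ≡ minT t → minT (miPerm σ t) ≡ α (minT t)
  minT-miPerm t σ {p} {l} σp≡p tpl≡min =
    minT-unique (miPerm σ t) p l (λ i l → α≤mi (minT-≤ t i l) (minT-≤ t (σ ⟨$⟩ʳ i) l)) (begin
      mi α β γ (t p l) (t (σ ⟨$⟩ʳ p) l)  ≡⟨ cong (λ q → mi α β γ (t p l) (t q l)) σp≡p ⟩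
      mi α β γ (t p l) (t p l)           ≡⟨ mi-diag (t p l) ⟩
      α (t p l)                          ≡⟨ cong α tpl≡min ⟩
      α (minT t)                         ∎)
    where open ≡-Reasoning

  minEntry-miPerm : ∀ {n k} (t : Tuple n k) σ {i l} → minT (miPerm σ t) ≡ α (minT t) →
                    miPerm σ t i l ≡ minT (miPerm σ t) → t i l ≡ minT t × t (σ ⟨$⟩ʳ i) l ≡ minT t
  minEntry-miPerm t σ {i} {l} min≡ e =
    mi≡α⇒≡ (minT-≤ t i l) (minT-≤ t (σ ⟨$⟩ʳ i) l) (trans e min≡)

module FilterLength where
  open import Data.List.Base using (_∷_; []; filter; length)
  open import Data.List.Membership.Propositional using (_∈_)
  open import Data.List.Relation.Unary.Any using (here; there)
  open import Relation.Unary using (Pred; Decidable; _⊆_)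

  module _ {a p q} {A : Set a} {P : Pred A p} {Q : Pred A q}
           (P? : Decidable P) (Q? : Decidable Q) (P⊆Q : P ⊆ Q) where

    length-filter-mono : ∀ xs → length (filter P? xs) ℕ.≤ length (filter Q? xs)
    length-filter-mono []       = ℕ.z≤n
    length-filter-mono (x ∷ xs) with P? x | Q? x
    ... | yes _  | yes _  = ℕ.s≤s (length-filter-mono xs)
    ... | yes Px | no ¬Qx = contradiction (P⊆Q Px) ¬Qx
    ... | no _   | yes _  = ℕ.m≤n⇒m≤1+n (length-filter-mono xs)
    ... | no _   | no _   = length-filter-mono xs

    length-filter-strict : ∀ {x xs} → x ∈ xs → Q x → ¬ P x →
                           length (filter P? xs) ℕ.< length (filter Q? xs)
    length-filter-strict {x} {_ ∷ xs} (here refl) Qx ¬Px with P? x | Q? x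
    ... | yes Px | _      = contradiction Px ¬Px
    ... | no _   | no ¬Qx = contradiction Qx ¬Qx
    ... | no _   | yes _  = ℕ.s≤s (length-filter-mono xs)
    length-filter-strict {_} {y ∷ xs} (there x∈xs) Qx ¬Px with P? y | Q? y
    ... | yes _  | yes _  = ℕ.s≤s (length-filter-strict x∈xs Qx ¬Px)
    ... | yes Py | no ¬Qy = contradiction (P⊆Q Py) ¬Qy
    ... | no _   | yes _  = ℕ.m<n⇒m<1+n (length-filter-strict x∈xs Qx ¬Px)
    ... | no _   | no _   = length-filter-strict x∈xs Qx ¬Px

module MinCount where
  open import Data.List.Base using (filter; length; cartesianProduct; allFin)
  open import Data.List.Membership.Propositional.Properties using (∈-cartesianProduct⁺; ∈-allFin)
  open import Data.Rational.Properties using (_≟_)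
  open Minimum using (M⇒minEntry)
  open FilterLength using (length-filter-strict)

  IsMinEntry : ∀ {n k} → Tuple n k → Fin n × Fin k → Set
  IsMinEntry t (i , l) = t i l ≡ minT t

  isMinEntry? : ∀ {n k} (t : Tuple n k) e → Dec (IsMinEntry t e)
  isMinEntry? t (i , l) = t i l ≟ minT t

  minCount : ∀ {n k} → Tuple n k → ℕ
  minCount {n} {k} t = length (filter (isMinEntry? t) (cartesianProduct (allFin n) (allFin k)))

  module _ {α β γ} (adm : Admissible α β γ) where
    open MiProperties adm using (miPerm; minT-miPerm; minEntry-miPerm)

    minCount-miPerm-< : ∀ {n k} (t : Tuple (suc n) (suc k)) σ {p r l} →
                        σ ⟨$⟩ʳ p ≡ p → M t p → t r l ≡ minT t → t (σ ⟨$⟩ʳ r) l ≢ minT t →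
                        minCount (miPerm σ t) ℕ.< minCount t
    minCount-miPerm-< t σ {r = r} {l} σp≡p Mp trl ¬tσrl =
      length-filter-strict (isMinEntry? (miPerm σ t)) (isMinEntry? t) (proj₁ ∘ bothMin)
        (∈-cartesianProduct⁺ (∈-allFin r) (∈-allFin l)) trl (¬tσrl ∘ proj₂ ∘ bothMin)
      where
      min≡ : minT (miPerm σ t) ≡ α (minT t)
      min≡ = minT-miPerm t σ σp≡p (proj₂ (M⇒minEntry t Mp))
      bothMin : ∀ {e} → IsMinEntry (miPerm σ t) e →
                IsMinEntry t e × IsMinEntry t (σ ⟨$⟩ʳ proj₁ e , proj₂ e)
      bothMin = minEntry-miPerm t σ min≡

module TwoTransitivity where
  open import Relation.Unary using (Pred; Decidable)

  thirdPoint : ∀ {n} (i j : Fin (suc (suc (suc n)))) → ∃ λ x → i ≢ x × j ≢ x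
  thirdPoint zero          zero          = suc zero , (λ ()) , (λ ())
  thirdPoint zero          (suc zero)    = suc (suc zero) , (λ ()) , (λ ())
  thirdPoint zero          (suc (suc _)) = suc zero , (λ ()) , (λ ())
  thirdPoint (suc zero)    zero          = suc (suc zero) , (λ ()) , (λ ())
  thirdPoint (suc (suc _)) zero          = suc zero , (λ ()) , (λ ())
  thirdPoint (suc _)       (suc _)       = zero , (λ ()) , (λ ())

  escape : ∀ {n p} {G : Permutation′ (suc (suc (suc n))) → Set} → TwoTransitiveGroup G →
           {S : Pred (Fin (suc (suc (suc n)))) p} → Decidable S → ∀ {i j} → S i → ¬ S j →
           ∃ λ σ → G σ × (σ ⟨$⟩ʳ i ≡ i ⊎ σ ⟨$⟩ʳ j ≡ j) × ∃ λ r → S r × ¬ S (σ ⟨$⟩ʳ r)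
  escape {G = G} 2-trans {S} S? {i} {j} Si ¬Sj =
    let x , i≢x , j≢x = thirdPoint i j in escapeVia i≢x j≢x (S? x)
    where
    i≢j : i ≢ j
    i≢j refl = ¬Sj Si
    escapeVia : ∀ {x} → i ≢ x → j ≢ x → Dec (S x) →
                ∃ λ σ → G σ × (σ ⟨$⟩ʳ i ≡ i ⊎ σ ⟨$⟩ʳ j ≡ j) × ∃ λ r → S r × ¬ S (σ ⟨$⟩ʳ r)
    escapeVia {x} i≢x j≢x (yes Sx) =
      let σ , Gσ , σi≡i , σx≡j = 2-trans i x i j i≢x i≢j in
      σ , Gσ , inj₁ σi≡i , x , Sx , ¬Sj ∘ subst S σx≡j
    escapeVia {x} i≢x j≢x (no ¬Sx) =
      let σ , Gσ , σj≡j , σi≡x = 2-trans j i j x (i≢j ∘ sym) j≢x in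
      σ , Gσ , inj₂ σj≡j , i , Si , ¬Sx ∘ subst S σi≡x

module Cleanliness where
  open import Data.Fin.Properties using (any?)
  open import Data.Rational.Properties using (_≟_)
  open import Relation.Nullary using (¬?; _×-dec_)

  Dirty : ∀ {n k} → Tuple n k → Set
  Dirty t = ∃ λ i → ∃ λ j → ∃ λ l → M t i × M t j × t i l ≡ minT t × t j l ≢ minT t

  dirty? : ∀ {n k} (t : Tuple n k) → Dec (Dirty t)
  dirty? t = any? λ i → any? λ j → any? λ l →
    M? i ×-dec M? j ×-dec (t i l ≟ minT t) ×-dec ¬? (t j l ≟ minT t)
    where
    M? : ∀ i → Dec (M t i)
    M? i = minF (t i) ≟ minT t

  minClean⊎dirty : ∀ {n k} (t : Tuple n k) → MinClean t ⊎ Dirty t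
  minClean⊎dirty t with dirty? t
  ... | yes dirty = inj₂ dirty
  ... | no ¬dirty = inj₁ λ i j Mi Mj l → transfer Mi Mj l , transfer Mj Mi l
    where
    transfer : ∀ {i j} → M t i → M t j → ∀ l → minx (t i) l → minx (t j) l
    transfer {i} {j} Mi Mj l til with t j l ≟ minT t
    ... | yes tjl = trans tjl (sym Mj)
    ... | no ¬tjl = contradiction (i , j , l , Mi , Mj , trans til Mi , ¬tjl) ¬dirty

module Cleaning {n k} {R : Relation (suc (suc (suc n))) (suc k)}
  {G : Permutation′ (suc (suc (suc n))) → Set} (2-trans : TwoTransitiveGroup G)
  (R-G : ∀ π → G π → ∀ t → R t → R (λ i → t (π ⟨$⟩ʳ i)))
  {α β γ} (adm : Admissible α β γ)
  (R-mi : ∀ s t → R s → R t → R (λ i l → mi α β γ (s i l) (t i l)))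
  where
  open import Data.Rational.Properties using (_≟_)
  open import Induction.WellFounded using (Acc; acc)
  open MiProperties adm using (miPerm)
  open MinCount using (minCount; minCount-miPerm-<)
  open TwoTransitivity using (escape)
  open Cleanliness using (minClean⊎dirty)

  minClean-from : ∀ t → Acc ℕ._<_ (minCount t) → R t → ∃ λ t′ → R t′ × MinClean t′
  minClean-from t (acc rec) Rt with minClean⊎dirty t
  ... | inj₁ clean = t , Rt , clean
  ... | inj₂ (i , j , l , Mi , Mj , til , ¬tjl)
    with escape 2-trans (λ r → t r l ≟ minT t) til ¬tjl
  ... | σ , Gσ , fixes , r , trl , ¬tσrl =
    let p , σp≡p , Mp = [ (λ σi≡i → i , σi≡i , Mi) , (λ σj≡j → j , σj≡j , Mj) ]′ fixes in
    minClean-from (miPerm σ t) (rec (minCount-miPerm-< adm t σ σp≡p Mp trl ¬tσrl))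
      (R-mi t _ Rt (R-G σ Gσ t Rt))

open import Data.Nat using (ℕ; _≤_)
open import Data.Nat.Base using (s≤s)
open import Data.Nat.Induction using (<-wellFounded)
open AdmissibleTriple using (∃-admissible)
open MinCount using (minCount)
open Cleaning using (minClean-from)

lemma5p7 : ∀ (n k : ℕ) → 3 ≤ n → 1 ≤ k → (R : Relation n k) →
    Nonempty R → Cyclic R → TwoTransitive R → PreservedByMi R →
    ∃ λ t → R t × MinClean t
lemma5p7 (suc (suc (suc n))) (suc k) (s≤s (s≤s (s≤s _))) (s≤s _) R (t , Rt) _ (_ , _ , 2-trans , R-G) R-mi =
  let α , β , γ , adm = ∃-admissible in
  minClean-from 2-trans R-G adm (R-mi α β γ adm) t (<-wellFounded (minCount t)) Rt
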